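{- Let $X$ be a totally ordered finite alphabet and let $\Phi$ be the second fundamental transformation on words over $X$. For every word $w$: (i) $w$ and $\Phi(w)$ end with the same letter; (ii) if $y$ and $y'$ are two letters of $X$ adjacent in the order of $X$, each occurring exactly once in $w$, and $y$ occurs to the left of $y'$ in $w$, then $y$ occurs to the left of $y'$ in $\Phi(w)$.
   Context: For $x\in X$ and a non-empty word $w$ the $x$-factorization of $w$ is defined as follows. If the last letter of $w$ is greater than $x$, write $w=w_1x_1w_2x_2\cdots w_hx_h$ where $x_1,\dots,x_h$ are letters greater than $x$ and $w_1,\dots,w_h$ are (possibly empty) words all of whose letters are $\le x$. If the last letter of $w$ is $\le x$, write $w=w_1x_1\cdots w_hx_h$ where $x_1,\dots,x_h$ are letters $\le x$ and all letters of $w_1,\dots,w_h$ are $>x$. Set $\gamma_x(w)=x_1w_1x_2w_2\cdots x_hw_h$. The map $\Phi$ is defined by $\Phi(w)=w$ if $w$ has length $0$ or $1$, and $\Phi(wx)=(\gamma_x\Phi(w))\,x$ for $x\in X$ and $w$ of positive length. -}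

module Defs where

open import Data.Bool using (Bool; true; false; if_then_else_; not)
open import Data.Nat using (ℕ; suc)
open import Data.Fin using (Fin; toℕ; _<?_; _≟_)
open import Data.List using (List; []; _∷_; _++_; [_]; _∷ʳ_; foldl; last; length; filter)
open import Data.Maybe using (Maybe; just; nothing)
open import Data.Product using (∃-syntax; _×_)
open import Data.Sum using (_⊎_)
open import Relation.Nullary using (does)
open import Relation.Binary.PropositionalEquality using (_≡_)

Word : ℕ → Set
Word n = List (Fin n)

gt : ∀ {n} → Fin n → Fin n → Bool
gt x a = does (x <? a)

-- Block rearrangement: given the separator class P (a Boolean predicate),
-- a word w = w₁ x₁ w₂ x₂ ⋯ wₕ xₕ (xᵢ ∈ P, letters of wᵢ ∉ P)
-- is sent to x₁ w₁ x₂ w₂ ⋯ xₕ wₕ.  `buf` holds the current block wᵢ.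
blocks : ∀ {n} → (Fin n → Bool) → Word n → Word n → Word n
blocks P buf []      = buf
blocks P buf (a ∷ w) = if P a then a ∷ (buf ++ blocks P [] w) else blocks P (buf ∷ʳ a) w

-- γₓ: if the last letter of w is > x, the separators are the letters > x;
-- otherwise (last letter ≤ x) the separators are the letters ≤ x.
-- (γₓ is only ever applied to non-empty words; γₓ [] = [].)
γ : ∀ {n} → Fin n → Word n → Word n
γ x w with last w
... | nothing = []
... | just z  = if gt x z then blocks (gt x) [] w else blocks (λ a → not (gt x a)) [] w

-- Φ(w) = w for |w| ≤ 1, Φ(w x) = γₓ(Φ w) x for |w| ≥ 1.
-- Implemented left to right: starting from [a₁], each further letter x
-- transforms the current word v into γₓ(v) x.
Φ : ∀ {n} → Word n → Word n
Φ []      = []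
Φ (a ∷ w) = foldl (λ v x → γ x v ∷ʳ x) [ a ] w

occ : ∀ {n} → Fin n → Word n → ℕ
occ y w = length (filter (y ≟_) w)

LeftOf : ∀ {n} → Fin n → Fin n → Word n → Set
LeftOf y y' w = ∃[ u ] ∃[ v ] ∃[ t ] (w ≡ u ++ y ∷ v ++ y' ∷ t)

Adjacent : ∀ {n} → Fin n → Fin n → Set
Adjacent y y' = (suc (toℕ y) ≡ toℕ y') ⊎ (suc (toℕ y') ≡ toℕ y)

{-# OPTIONS --safe #-}
-- γₓ only interleaves the letters > x with the letters ≤ x, keeping
-- each of the two subsequences in order; so a subsequence of w whose letters all lie
-- on the same side of x is still a subsequence of γₓ(w).  As Φ(w x) = γₓ(Φ w) x,
-- part (i) is immediate, and (ii) follows by induction on the length of w: if y' is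
-- the appended letter x, it comes after y anyway; otherwise y, y' both differ from x
-- (they occur only once), and being adjacent in the order they lie on the same side
-- of x.
module Submission where

open import Data.Bool using (Bool; true; false; not)
import Data.Bool as Bool
open import Data.Bool.Properties using (not-¬)
open import Data.Fin using (Fin; _<?_; _≟_)
open import Data.Fin.Properties using (toℕ-injective)
open import Data.List using (List; []; _∷_; _++_; [_]; _∷ʳ_; last; length; filter)
open import Data.List.Membership.Propositional using (_∈_)
open import Data.List.Membership.Propositional.Properties using (∈-∃++; ∈-++⁻; ∈-++⁺ˡ; ∈-++⁺ʳ)
open import Data.List.Properties
  using (filter-all; filter-none; filter-accept; filter-reject; filter-++; filter-some;
         length-++; ++-assoc; ++-identityʳ; foldl-∷ʳ; ∷ʳ-injective)
open import Data.List.Relation.Binary.Sublist.Propositional as Sublist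
  using (_⊆_; []; _∷_; ⊆-refl; from∈; to∈)
open import Data.List.Relation.Binary.Sublist.Propositional.Properties
  using (++⁺; ++⁺ˡ; ++⁺ʳ; ∷ˡ⁻; []⊆-universal; filter⁺; filter-⊆; module ⊆-Reasoning)
open import Data.List.Relation.Unary.All as All using (All; []; _∷_)
import Data.List.Relation.Unary.All.Properties as Allₚ
open import Data.List.Reverse using (Reverse; reverseView; []; _∶_∶ʳ_)
open import Data.Maybe using (just)
open import Data.Nat as ℕ using (ℕ; suc; _+_; _<_)
open import Data.Nat.Properties using (m<n⇒m<1+n; ≤∧≢⇒<; +-identityʳ; +-cancelʳ-≡; n>0⇒n≢0)
open import Data.Product using (_×_; ∃-syntax; _,_)
open import Data.Sum using (_⊎_; inj₁; inj₂)
open import Function using (_∘_; _⇔_; mk⇔)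
open import Relation.Nullary using (yes; no; contradiction)
open import Relation.Nullary.Decidable using (does-⇔)
open import Relation.Unary using (Decidable)
open import Relation.Binary.PropositionalEquality
  using (_≡_; _≢_; refl; sym; trans; cong; cong₂; subst; module ≡-Reasoning)

open import Defs

private variable
  n : ℕ
  y y' : Fin n
  w : Word n

LeftOf⇒⊆ : LeftOf y y' w → y ∷ y' ∷ [] ⊆ w
LeftOf⇒⊆ (u , v , t , refl) = ++⁺ˡ u (refl ∷ ++⁺ˡ v (refl ∷ []⊆-universal t))

⊆⇒LeftOf : y ∷ y' ∷ [] ⊆ w → LeftOf y y' w
⊆⇒LeftOf (a Sublist.∷ʳ p) with u , v , t , refl ← ⊆⇒LeftOf p = a ∷ u , v , t , refl
⊆⇒LeftOf (refl ∷ p) with v , t , refl ← ∈-∃++ (to∈ p) = [] , v , t , refl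

⊆-∷ʳ⁻ : {A : Set} {us xs : List A} {x : A} → us ⊆ xs ∷ʳ x →
        us ⊆ xs ⊎ ∃[ vs ] (us ≡ vs ∷ʳ x × vs ⊆ xs)
⊆-∷ʳ⁻ {xs = []} (_ Sublist.∷ʳ []) = inj₁ []
⊆-∷ʳ⁻ {xs = []} (refl ∷ []) = inj₂ ([] , refl , [])
⊆-∷ʳ⁻ {xs = a ∷ xs} (.a Sublist.∷ʳ p) with ⊆-∷ʳ⁻ p
... | inj₁ q = inj₁ (a Sublist.∷ʳ q)
... | inj₂ (vs , e , q) = inj₂ (vs , e , a Sublist.∷ʳ q)
⊆-∷ʳ⁻ {xs = a ∷ xs} (refl ∷ p) with ⊆-∷ʳ⁻ p
... | inj₁ q = inj₁ (refl ∷ q)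
... | inj₂ (vs , refl , q) = inj₂ (a ∷ vs , refl , refl ∷ q)

last-∷ʳ : {A : Set} (xs : List A) (x : A) → last (xs ∷ʳ x) ≡ just x
last-∷ʳ [] x = refl
last-∷ʳ (a ∷ []) x = refl
last-∷ʳ (a ∷ b ∷ xs) x = last-∷ʳ (b ∷ xs) x

occ-++ : (y : Fin n) (xs ys : Word n) → occ y (xs ++ ys) ≡ occ y xs + occ y ys
occ-++ y xs ys = trans (cong length (filter-++ (y ≟_) xs ys)) (length-++ (filter (y ≟_) xs))

occ-∷ʳ-self : (y : Fin n) (xs : Word n) → occ y (xs ∷ʳ y) ≡ occ y xs + 1
occ-∷ʳ-self y xs =
  trans (occ-++ y xs [ y ]) (cong ((occ y xs +_) ∘ length) (filter-accept (y ≟_) {xs = []} refl))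

occ-∷ʳ-other : ∀ {x} (xs : Word n) → x ≢ y → occ y (xs ∷ʳ x) ≡ occ y xs
occ-∷ʳ-other {y = y} {x} xs x≢y = begin
  occ y (xs ∷ʳ x)           ≡⟨ occ-++ y xs [ x ] ⟩
  occ y xs + occ y [ x ]    ≡⟨ cong ((occ y xs +_) ∘ length) (filter-reject (y ≟_) {xs = []} (x≢y ∘ sym)) ⟩
  occ y xs + 0              ≡⟨ +-identityʳ _ ⟩
  occ y xs                  ∎
  where open ≡-Reasoning

occ-∷ʳ-unique : ∀ {xs x} → y ∈ xs → occ y (xs ∷ʳ x) ≡ 1 → x ≢ y × occ y xs ≡ 1
occ-∷ʳ-unique {y = y} {xs} {x} y∈xs once with x ≟ y
... | no x≢y = x≢y , trans (sym (occ-∷ʳ-other xs x≢y)) once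
... | yes refl = contradiction (+-cancelʳ-≡ 1 (occ y xs) 0 (trans (sym (occ-∷ʳ-self y xs)) once))
                               (n>0⇒n≢0 (filter-some (y ≟_) y∈xs))

<-adjacent : ∀ {a b c} → suc b ≡ c → a ≢ b → a < b ⇔ a < c
<-adjacent refl a≢b = mk⇔ m<n⇒m<1+n (λ a<1+b → ≤∧≢⇒< (ℕ.s≤s⁻¹ a<1+b) a≢b)

gt-adjacent : ∀ {x} → Adjacent y y' → x ≢ y → x ≢ y' → gt x y ≡ gt x y'
gt-adjacent {y = y} {y'} {x} (inj₁ y+1≡y') x≢y _ =
  does-⇔ (<-adjacent y+1≡y' (x≢y ∘ toℕ-injective)) (x <? y) (x <? y')
gt-adjacent {y = y} {y'} {x} (inj₂ y'+1≡y) _ x≢y' =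
  sym (does-⇔ (<-adjacent y'+1≡y (x≢y' ∘ toℕ-injective)) (x <? y') (x <? y))

class? : (P : Fin n → Bool) (b : Bool) → Decidable (λ a → P a ≡ b)
class? P b a = P a Bool.≟ b

filter-∷-swap : ∀ (P : Fin n → Bool) b {a buf} → P a ≡ true → All (λ c → P c ≡ false) buf →
                filter (class? P b) (a ∷ buf) ≡ filter (class? P b) (buf ∷ʳ a)
filter-∷-swap P true {a} {buf} Pa buf-false = begin
  filter Q (a ∷ buf)              ≡⟨ filter-accept Q Pa ⟩
  a ∷ filter Q buf                ≡⟨ cong (a ∷_) none ⟩
  [ a ]                           ≡⟨ filter-accept Q {xs = []} Pa ⟨
  filter Q [ a ]                  ≡⟨ cong (_++ filter Q [ a ]) none ⟨
  filter Q buf ++ filter Q [ a ]  ≡⟨ filter-++ Q buf [ a ] ⟨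
  filter Q (buf ∷ʳ a)             ∎
  where
  open ≡-Reasoning
  Q = class? P true
  none : filter Q buf ≡ []
  none = filter-none Q (All.map not-¬ buf-false)
filter-∷-swap P false {a} {buf} Pa buf-false = begin
  filter Q (a ∷ buf)              ≡⟨ filter-reject Q (not-¬ Pa) ⟩
  filter Q buf                    ≡⟨ ++-identityʳ _ ⟨
  filter Q buf ++ []              ≡⟨ cong (filter Q buf ++_) (filter-reject Q {xs = []} (not-¬ Pa)) ⟨
  filter Q buf ++ filter Q [ a ]  ≡⟨ filter-++ Q buf [ a ] ⟨
  filter Q (buf ∷ʳ a)             ∎
  where
  open ≡-Reasoning
  Q = class? P false

filter-blocks : ∀ (P : Fin n → Bool) b {buf} w → All (λ c → P c ≡ false) buf →
                filter (class? P b) (blocks P buf w) ≡ filter (class? P b) (buf ++ w)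
filter-blocks P b {buf} [] _ = cong (filter (class? P b)) (sym (++-identityʳ buf))
filter-blocks P b {buf} (a ∷ w) buf-false with P a in Pa
... | true = begin
  filter Q (a ∷ buf ++ blocks P [] w)              ≡⟨ filter-++ Q (a ∷ buf) _ ⟩
  filter Q (a ∷ buf) ++ filter Q (blocks P [] w)   ≡⟨ cong₂ _++_ (filter-∷-swap P b Pa buf-false)
                                                                 (filter-blocks P b w []) ⟩
  filter Q (buf ∷ʳ a) ++ filter Q w                ≡⟨ filter-++ Q (buf ∷ʳ a) w ⟨
  filter Q (buf ∷ʳ a ++ w)                         ≡⟨ cong (filter Q) (++-assoc buf [ a ] w) ⟩
  filter Q (buf ++ a ∷ w)                          ∎
  where
  open ≡-Reasoning
  Q = class? P b
... | false = trans (filter-blocks P b w (Allₚ.++⁺ buf-false (Pa ∷ [])))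
                    (cong (filter (class? P b)) (++-assoc buf [ a ] w))

⊆-blocks : ∀ (P : Fin n → Bool) b {us} w → All (λ c → P c ≡ b) us → us ⊆ w → us ⊆ blocks P [] w
⊆-blocks P b {us} w monochrome us⊆w = begin
  us                        ≡⟨ filter-all Q monochrome ⟨
  filter Q us               ⊆⟨ filter⁺ Q Q (λ { refl Pc → Pc }) us⊆w ⟩
  filter Q w                ≡⟨ filter-blocks P b w [] ⟨
  filter Q (blocks P [] w)  ⊆⟨ filter-⊆ Q _ ⟩
  blocks P [] w             ∎
  where
  open ⊆-Reasoning
  Q = class? P b

γ-blocks : ∀ (x : Fin n) v → γ x v ≡ blocks (gt x) [] v ⊎ γ x v ≡ blocks (not ∘ gt x) [] v
γ-blocks x v with reverseView v
... | [] = inj₁ refl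
... | xs ∶ _ ∶ʳ z rewrite last-∷ʳ xs z with gt x z
...   | true  = inj₁ refl
...   | false = inj₂ refl

⊆-γ : ∀ (x : Fin n) b {us} v → All (λ c → gt x c ≡ b) us → us ⊆ v → us ⊆ γ x v
⊆-γ x b v monochrome us⊆v with γ-blocks x v
... | inj₁ γ≡ = subst (_ ⊆_) (sym γ≡) (⊆-blocks (gt x) b v monochrome us⊆v)
... | inj₂ γ≡ = subst (_ ⊆_) (sym γ≡)
                      (⊆-blocks (not ∘ gt x) (not b) v (All.map (cong not) monochrome) us⊆v)

∈-γ : ∀ (x : Fin n) {v} → y ∈ v → y ∈ γ x v
∈-γ {y = y} x y∈v = to∈ (⊆-γ x (gt x y) _ (refl ∷ []) (from∈ y∈v))

Φ-∷ʳ : ∀ (a : Fin n) xs x → Φ (a ∷ xs ∷ʳ x) ≡ γ x (Φ (a ∷ xs)) ∷ʳ x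
Φ-∷ʳ a xs x = foldl-∷ʳ (λ v z → γ z v ∷ʳ z) [ a ] x xs

last-Φ : ∀ (w : Word n) → last (Φ w) ≡ last w
last-Φ w with reverseView w
... | [] = refl
... | [] ∶ _ ∶ʳ x = refl
... | (a ∷ xs) ∶ _ ∶ʳ x = begin
  last (Φ (a ∷ xs ∷ʳ x))           ≡⟨ cong last (Φ-∷ʳ a xs x) ⟩
  last (γ x (Φ (a ∷ xs)) ∷ʳ x)     ≡⟨ last-∷ʳ (γ x (Φ (a ∷ xs))) x ⟩
  just x                           ≡⟨ last-∷ʳ (a ∷ xs) x ⟨
  last (a ∷ xs ∷ʳ x)               ∎
  where open ≡-Reasoning

∈-Φ : y ∈ w → y ∈ Φ w
∈-Φ {w = w} = go (reverseView w)
  where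
  go : ∀ {w} → Reverse w → y ∈ w → y ∈ Φ w
  go ([] ∶ _ ∶ʳ x) y∈w = y∈w
  go ((a ∷ xs) ∶ rs ∶ʳ x) y∈w rewrite Φ-∷ʳ a xs x with ∈-++⁻ (a ∷ xs) y∈w
  ... | inj₁ y∈xs = ∈-++⁺ˡ (∈-γ x (go rs y∈xs))
  ... | inj₂ y∈[x] = ∈-++⁺ʳ _ y∈[x]

Φ-preserves-order : Adjacent y y' → occ y w ≡ 1 → occ y' w ≡ 1 →
                    y ∷ y' ∷ [] ⊆ w → y ∷ y' ∷ [] ⊆ Φ w
Φ-preserves-order {y = y} {y'} {w = w} adj = go (reverseView w)
  where
  go : ∀ {w} → Reverse w → occ y w ≡ 1 → occ y' w ≡ 1 → y ∷ y' ∷ [] ⊆ w → y ∷ y' ∷ [] ⊆ Φ w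
  go ([] ∶ _ ∶ʳ x) _ _ yy'⊆w = yy'⊆w
  go ((a ∷ xs) ∶ rs ∶ʳ x) once once' yy'⊆w
    rewrite Φ-∷ʳ a xs x with ⊆-∷ʳ⁻ {xs = a ∷ xs} {x = x} yy'⊆w
  ... | inj₂ (vs , yy'≡vsx , vs⊆xs) with refl , refl ← ∷ʳ-injective [ y ] vs yy'≡vsx =
    ++⁺ (from∈ (∈-γ x (∈-Φ (to∈ vs⊆xs)))) ⊆-refl
  ... | inj₁ yy'⊆xs
    with x≢y  , once-xs  ← occ-∷ʳ-unique (to∈ yy'⊆xs) once
       | x≢y' , once'-xs ← occ-∷ʳ-unique (to∈ (∷ˡ⁻ yy'⊆xs)) once' =
    ++⁺ʳ [ x ] (⊆-γ x (gt x y) _ (refl ∷ sym (gt-adjacent adj x≢y x≢y') ∷ [])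
                                 (go rs once-xs once'-xs yy'⊆xs))

proposition5p1 : (n : ℕ) → (w : Word n) →
    (last (Φ w) ≡ last w) ×
    ((y y' : Fin n) → Adjacent y y' → occ y w ≡ 1 → occ y' w ≡ 1 →
      LeftOf y y' w → LeftOf y y' (Φ w))
proposition5p1 n w =
  last-Φ w ,
  λ y y' adj once once' y<y' → ⊆⇒LeftOf (Φ-preserves-order adj once once' (LeftOf⇒⊆ y<y'))
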